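{- Let $r_n$ be the starting position of the first occurrence of the word $1^n$ in $\mathbf{b}$. Then $r_1 = 1$, $r_2 = 5$, and $r_{n+1} = 2^{r_n - 2} + r_n$ for all $n \geq 2$.
   Context: Define finite binary words $B_i$ by $B_1 = 101$ and $B_{i+1} = B_i C_i$ for $i \geq 1$, where $C_i$ is the word obtained from $B_i$ by removing its first $i$ symbols. Since each $B_i$ is a prefix of $B_{i+1}$, there is a unique infinite binary word $\mathbf{b}$ of which every $B_i$ is a prefix. Words are indexed starting at position $1$; $1^n$ denotes the word consisting of $n$ ones. -}

module Defs where

open import Data.Nat using (ℕ; zero; suc; _+_; _∸_; _≤_; _<_)
open import Data.Bool using (Bool; true; false)
open import Data.List using (List; []; _∷_; _++_; drop)
open import Data.Product using (_×_)
open import Relation.Nullary using (¬_)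
open import Relation.Binary.PropositionalEquality using (_≡_)

-- B i for i ≥ 1: B 1 = 101, B (i+1) = B i ++ C i, C i = B i with first i symbols removed.
-- (B 0 is an unused junk value; we set it to 101 too.)
B : ℕ → List Bool
B zero = true ∷ false ∷ true ∷ []
B (suc zero) = true ∷ false ∷ true ∷ []
B (suc (suc i)) = B (suc i) ++ drop (suc i) (B (suc i))

-- symbol at 1-based position p of a list (false if out of range / p = 0)
at : List Bool → ℕ → Bool
at [] _ = false
at (x ∷ xs) zero = false
at (x ∷ xs) (suc zero) = x
at (x ∷ xs) (suc (suc p)) = at xs (suc p)

-- the infinite word b, 1-indexed: b p is the p-th symbol of b (p ≥ 1).
-- |B p| ≥ p + 2, and each B i is a prefix of all later ones, so B p
-- determines the p-th symbol of b.
b : ℕ → Bool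
b p = at (B p) p

OccursOnesAt : ℕ → ℕ → Set
OccursOnesAt n r = ∀ k → k < n → b (r + k) ≡ true

IsFirstOcc : ℕ → ℕ → Set
IsFirstOcc n r = (1 ≤ r) × OccursOnesAt n r × (∀ q → 1 ≤ q → q < r → ¬ OccursOnesAt n q)

{-# OPTIONS --safe #-}
module Submission where

open import Defs
open import Data.Bool using (Bool; true; false)
open import Data.List using (List; []; _∷_; _++_; drop; length)
open import Data.List.Properties using (length-++; length-drop)
open import Data.Nat
  using (ℕ; zero; suc; _+_; _∸_; _^_; _≤_; _<_; _<?_; z≤n; s≤s; s≤s⁻¹; _≤′_; ≤′-refl; ≤′-step)
open import Data.Nat.Properties
open import Data.Nat.Tactic.RingSolver using (solve-∀)
open import Data.Product using (Σ; ∃-syntax; _×_; _,_)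
open import Data.Sum using (inj₁; inj₂)
open import Relation.Nullary using (¬_; yes; no; contradiction)
open import Relation.Binary.PropositionalEquality

-- B (i + 2) is B (i + 1) followed by a copy C of its symbols i + 2, …, ℓ i, where
-- ℓ i = |B (i + 1)| = i + 2 + 2^i. Every B (i + 1) ends in 01, so b has a 1 at ℓ i and a 0
-- at ℓ i − 1; this 0 lies in the copied part and reappears at ℓ i + 2^i, inside C.
-- No run of ones crosses these 0s. Hence a run starting at j + 2 is copied to start just
-- after the 1 at ℓ j and becomes one symbol longer there; conversely a run of length ≥ 2
-- starting at q either starts at some ℓ j, and then its tail comes from a run at j + 2, or
-- lies inside a copy and moves back to its earlier source. So if 1^n first occurs at
-- r n = j + 2, then 1^(n+1) first occurs at ℓ j = 2^(r n − 2) + r n.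

at-++ˡ : ∀ (xs ys : List Bool) {p} → p ≤ length xs → at (xs ++ ys) p ≡ at xs p
at-++ˡ []       []      z≤n = refl
at-++ˡ []       (_ ∷ _) z≤n = refl
at-++ˡ (x ∷ xs) ys {zero}        _       = refl
at-++ˡ (x ∷ xs) ys {suc zero}    _       = refl
at-++ˡ (x ∷ xs) ys {suc (suc p)} (s≤s h) = at-++ˡ xs ys h

at-++ʳ : ∀ (xs ys : List Bool) k → at (xs ++ ys) (suc (length xs + k)) ≡ at ys (suc k)
at-++ʳ []       ys k = refl
at-++ʳ (x ∷ xs) ys k = at-++ʳ xs ys k

at-drop : ∀ i (xs : List Bool) k → at (drop i xs) (suc k) ≡ at xs (suc (i + k))
at-drop zero    xs       k = refl
at-drop (suc i) []       k = refl
at-drop (suc i) (x ∷ xs) k = at-drop i xs k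

ℓ : ℕ → ℕ
ℓ i = suc i + suc (2 ^ i)

ℓ-suc : ∀ i → ℓ (suc i) ≡ ℓ i + suc (2 ^ i)
ℓ-suc i = identity i (2 ^ i)
  where
  identity : ∀ i e → suc (suc i) + suc (e + (e + 0)) ≡ suc i + suc e + suc e
  identity = solve-∀

ℓ≡2^i+[2+i] : ∀ i → ℓ i ≡ 2 ^ i + (2 + i)
ℓ≡2^i+[2+i] i = identity i (2 ^ i)
  where
  identity : ∀ i e → suc i + suc e ≡ e + (2 + i)
  identity = solve-∀

ℓ-mono-≤ : ∀ {i j} → i ≤ j → ℓ i ≤ ℓ j
ℓ-mono-≤ i≤j = +-mono-≤ (s≤s i≤j) (s≤s (^-monoʳ-≤ 2 i≤j))

ℓ-cancel-< : ∀ {i j} → ℓ i < ℓ j → i < j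
ℓ-cancel-< ℓi<ℓj = ≰⇒> (λ j≤i → <⇒≱ ℓi<ℓj (ℓ-mono-≤ j≤i))

length-B : ∀ i → length (B (suc i)) ≡ ℓ i
length-B zero    = refl
length-B (suc i) = begin
    length (B (suc i) ++ drop (suc i) (B (suc i)))
  ≡⟨ length-++ (B (suc i)) ⟩
    length (B (suc i)) + length (drop (suc i) (B (suc i)))
  ≡⟨ cong (length (B (suc i)) +_) (length-drop (suc i) (B (suc i))) ⟩
    length (B (suc i)) + (length (B (suc i)) ∸ suc i)
  ≡⟨ cong (λ t → t + (t ∸ suc i)) (length-B i) ⟩
    ℓ i + (ℓ i ∸ suc i)
  ≡⟨ cong (ℓ i +_) (m+n∸m≡n (suc i) (suc (2 ^ i))) ⟩
    ℓ i + suc (2 ^ i)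
  ≡⟨ ℓ-suc i ⟨
    ℓ (suc i)
  ∎
  where open ≡-Reasoning

length-B-≤-suc : ∀ n → length (B n) ≤ length (B (suc n))
length-B-≤-suc zero    = ≤-refl
length-B-≤-suc (suc n) =
  subst (length (B (suc n)) ≤_) (sym (length-++ (B (suc n)))) (m≤m+n _ _)

length-B-mono : ∀ {m n} → m ≤′ n → length (B m) ≤ length (B n)
length-B-mono ≤′-refl             = ≤-refl
length-B-mono (≤′-step {n} m≤′n) = ≤-trans (length-B-mono m≤′n) (length-B-≤-suc n)

at-B-suc : ∀ n {p} → p ≤ length (B n) → at (B (suc n)) p ≡ at (B n) p
at-B-suc zero    _ = refl
at-B-suc (suc n)   = at-++ˡ (B (suc n)) _

at-B-stable : ∀ {m n p} → m ≤′ n → p ≤ length (B m) → at (B n) p ≡ at (B m) p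
at-B-stable ≤′-refl              _  = refl
at-B-stable (≤′-step {n} m≤′n) p≤ =
  trans (at-B-suc n (≤-trans p≤ (length-B-mono m≤′n))) (at-B-stable m≤′n p≤)

n≤length-B : ∀ n → n ≤ length (B n)
n≤length-B zero    = z≤n
n≤length-B (suc n) = subst (suc n ≤_) (sym (length-B n)) (m≤m+n (suc n) _)

b-at-B : ∀ n {p} → p ≤ length (B n) → b p ≡ at (B n) p
b-at-B n {p} p≤ with ≤-total n p
... | inj₁ n≤p = at-B-stable (≤⇒≤′ n≤p) p≤
... | inj₂ p≤n = sym (at-B-stable (≤⇒≤′ p≤n) (n≤length-B p))

b-at-B-suc : ∀ i {p} → p ≤ ℓ i → b p ≡ at (B (suc i)) p
b-at-B-suc i p≤ℓ = b-at-B (suc i) (subst (_ ≤_) (sym (length-B i)) p≤ℓ)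

b-copy : ∀ i {x} → 1 ≤ x → x ≤ suc (2 ^ i) → b (ℓ i + x) ≡ b (suc i + x)
b-copy i {suc k} _ (s≤s k≤2^i) = begin
    b (ℓ i + suc k)
  ≡⟨ b-at-B-suc (suc i) copy-end ⟩
    at (B (suc i) ++ C) (ℓ i + suc k)
  ≡⟨ cong (at (B (suc i) ++ C)) (+-suc (ℓ i) k) ⟩
    at (B (suc i) ++ C) (suc (ℓ i + k))
  ≡⟨ cong (λ t → at (B (suc i) ++ C) (suc (t + k))) (length-B i) ⟨
    at (B (suc i) ++ C) (suc (length (B (suc i)) + k))
  ≡⟨ at-++ʳ (B (suc i)) C k ⟩
    at C (suc k)
  ≡⟨ at-drop (suc i) (B (suc i)) k ⟩
    at (B (suc i)) (suc (suc i + k))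
  ≡⟨ cong (at (B (suc i))) (+-suc (suc i) k) ⟨
    at (B (suc i)) (suc i + suc k)
  ≡⟨ b-at-B-suc i source-end ⟨
    b (suc i + suc k)
  ∎
  where
  open ≡-Reasoning
  C : List Bool
  C = drop (suc i) (B (suc i))
  copy-end : ℓ i + suc k ≤ ℓ (suc i)
  copy-end = ≤-trans (+-monoʳ-≤ (ℓ i) (s≤s k≤2^i)) (≤-reflexive (sym (ℓ-suc i)))
  source-end : suc i + suc k ≤ ℓ i
  source-end = +-monoʳ-≤ (suc i) (s≤s k≤2^i)

b-ℓ : ∀ i → b (ℓ i) ≡ true
b-ℓ zero    = refl
b-ℓ (suc i) = trans (cong b (ℓ-suc i)) (trans (b-copy i (s≤s z≤n) ≤-refl) (b-ℓ i))

ℓ+2^i≡2+i+2^[1+i] : ∀ i → ℓ i + 2 ^ i ≡ suc (suc i) + 2 ^ suc i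
ℓ+2^i≡2+i+2^[1+i] i = identity i (2 ^ i)
  where
  identity : ∀ i e → suc i + suc e + e ≡ suc (suc i) + (e + (e + 0))
  identity = solve-∀

b-zero : ∀ i → b (suc i + 2 ^ i) ≡ false
b-zero zero    = refl
b-zero (suc i) =
  trans (cong b (sym (ℓ+2^i≡2+i+2^[1+i] i)))
    (trans (b-copy i (m^n>0 2 i) (n≤1+n _)) (b-zero i))

b-zero-copy : ∀ i → b (ℓ i + 2 ^ i) ≡ false
b-zero-copy i = trans (cong b (ℓ+2^i≡2+i+2^[1+i] i)) (b-zero (suc i))

ones-before-zero : ∀ {n x z} p → OccursOnesAt n (p + x) → b (p + z) ≡ false →
                   x ≤ z → x + n ≤ z
ones-before-zero {n} {x} {z} p occ b≡false x≤z = begin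
    x + n        ≤⟨ +-monoʳ-≤ x n≤gap ⟩
    x + (z ∸ x)  ≡⟨ m+[n∸m]≡n x≤z ⟩
    z            ∎
  where
  open ≤-Reasoning
  z≡ : p + z ≡ p + x + (z ∸ x)
  z≡ = trans (cong (p +_) (sym (m+[n∸m]≡n x≤z))) (sym (+-assoc p x (z ∸ x)))
  n≤gap : n ≤ z ∸ x
  n≤gap = ≮⇒≥ λ gap<n →
    contradiction (trans (sym b≡false) (trans (cong b z≡) (occ (z ∸ x) gap<n))) λ ()

ones-transport : ∀ {n} p q → (∀ k → k < n → b (p + k) ≡ b (q + k)) →
                 OccursOnesAt n p → OccursOnesAt n q
ones-transport _ _ same occ k k<n = trans (sym (same k k<n)) (occ k k<n)

ones-copy : ∀ i {x n} → 1 ≤ x → x + n ≤ 2 ^ i →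
            ∀ k → k < n → b (ℓ i + x + k) ≡ b (suc i + x + k)
ones-copy i {x} 1≤x bound k k<n = begin
    b (ℓ i + x + k)      ≡⟨ cong b (+-assoc (ℓ i) x k) ⟩
    b (ℓ i + (x + k))    ≡⟨ b-copy i (≤-trans 1≤x (m≤m+n x k)) x+k≤ ⟩
    b (suc i + (x + k))  ≡⟨ cong b (+-assoc (suc i) x k) ⟨
    b (suc i + x + k)    ∎
  where
  open ≡-Reasoning
  x+k≤ : x + k ≤ suc (2 ^ i)
  x+k≤ = m≤n⇒m≤1+n (<⇒≤ (<-≤-trans (+-monoʳ-< x k<n) bound))

ones-copy-back : ∀ i {x n} → 1 ≤ x → x ≤ 2 ^ i →
                 OccursOnesAt n (ℓ i + x) → OccursOnesAt n (suc i + x)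
ones-copy-back i {x} 1≤x x≤2^i occ = ones-transport (ℓ i + x) (suc i + x)
  (ones-copy i 1≤x (ones-before-zero (ℓ i) occ (b-zero-copy i) x≤2^i)) occ

ones-copy-forward : ∀ i {x n} → 1 ≤ x → x ≤ 2 ^ i →
                    OccursOnesAt n (suc i + x) → OccursOnesAt n (ℓ i + x)
ones-copy-forward i {x} {n} 1≤x x≤2^i occ = ones-transport (suc i + x) (ℓ i + x)
  (λ k k<n → sym (ones-copy i 1≤x bound k k<n)) occ
  where
  bound : x + n ≤ 2 ^ i
  bound = ones-before-zero (suc i) occ (b-zero i) x≤2^i

ones-tail : ∀ {n p} → OccursOnesAt (suc n) p → OccursOnesAt n (p + 1)
ones-tail {p = p} occ k k<n = trans (cong b (+-assoc p 1 k)) (occ (suc k) (s≤s k<n))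

ones-cons : ∀ {n p} → b p ≡ true → OccursOnesAt n (p + 1) → OccursOnesAt (suc n) p
ones-cons {p = p} bp occ zero    _         = trans (cong b (+-identityʳ p)) bp
ones-cons {p = p} bp occ (suc k) (s≤s k<n) = trans (cong b (sym (+-assoc p 1 k))) (occ k k<n)

ones-ℓ⁺ : ∀ {n} j → OccursOnesAt n (2 + j) → OccursOnesAt (suc n) (ℓ j)
ones-ℓ⁺ j occ =
  ones-cons {p = ℓ j} (b-ℓ j)
    (ones-copy-forward j ≤-refl (m^n>0 2 j) (subst (OccursOnesAt _) (+-comm 1 (suc j)) occ))

ones-ℓ⁻ : ∀ {n} j → OccursOnesAt (suc n) (ℓ j) → OccursOnesAt n (2 + j)
ones-ℓ⁻ j occ =
  subst (OccursOnesAt _) (+-comm (suc j) 1)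
    (ones-copy-back j ≤-refl (m^n>0 2 j) (ones-tail {p = ℓ j} occ))

ℓ-copy-bound : ∀ i {x} → ℓ i + x < ℓ (suc i) → x ≤ 2 ^ i
ℓ-copy-bound i {x} lt =
  s≤s⁻¹ (+-cancelˡ-< (ℓ i) x (suc (2 ^ i)) (subst (ℓ i + x <_) (ℓ-suc i) lt))

ones-descend : ∀ i {n q} → 1 ≤ q → q < ℓ i → OccursOnesAt (2 + n) q →
               ∃[ j ] ℓ j ≤ q × OccursOnesAt (suc n) (2 + j)
-- b = 10101101…
ones-descend zero {q = 1} _ _ occ = contradiction (occ 1 (s≤s (s≤s z≤n))) λ ()
ones-descend zero {q = 2} _ _ occ = contradiction (occ 0 (s≤s z≤n)) λ ()
ones-descend zero {q = suc (suc (suc _))} _ (s≤s (s≤s (s≤s ()))) _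
ones-descend (suc i) {q = q} 1≤q q<ℓ occ with q <? ℓ i
... | yes q<ℓi = ones-descend i 1≤q q<ℓi occ
... | no  q≮ℓi with m≤n⇒∃[o]m+o≡n (≮⇒≥ q≮ℓi)
...   | zero , refl =
  i , m≤m+n (ℓ i) 0 , ones-ℓ⁻ i (subst (OccursOnesAt _) (+-identityʳ (ℓ i)) occ)
...   | suc x , refl
  with ones-descend i (s≤s z≤n) (+-monoʳ-< (suc i) (s≤s (ℓ-copy-bound i q<ℓ)))
                    (ones-copy-back i (s≤s z≤n) (ℓ-copy-bound i q<ℓ) occ)
...     | j , ℓj≤ , occ′ =
  j , ≤-trans ℓj≤ (+-monoˡ-≤ (suc x) (m≤m+n (suc i) _)) , occ′

firstOcc-step : ∀ {n j} → IsFirstOcc (suc n) (2 + j) → IsFirstOcc (2 + n) (ℓ j)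
firstOcc-step {n} {j} (_ , occ , first) = s≤s z≤n , ones-ℓ⁺ j occ , earlier
  where
  earlier : ∀ q → 1 ≤ q → q < ℓ j → ¬ OccursOnesAt (2 + n) q
  earlier q 1≤q q<ℓj occ′ with ones-descend j 1≤q q<ℓj occ′
  ... | j′ , ℓj′≤q , occ″ =
    first (2 + j′) (s≤s z≤n) (s≤s (s≤s j′<j)) occ″
    where
    j′<j : j′ < j
    j′<j = ℓ-cancel-< (≤-<-trans ℓj′≤q q<ℓj)

firstOcc-1 : IsFirstOcc 1 1
firstOcc-1 = s≤s z≤n , occ , λ _ 1≤q q<1 _ → <⇒≱ q<1 1≤q
  where
  occ : OccursOnesAt 1 1
  occ zero    _ = refl
  occ (suc _) (s≤s ())

firstOcc-2 : IsFirstOcc 2 5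
firstOcc-2 = s≤s z≤n , occ , earlier
  where
  occ : OccursOnesAt 2 5
  occ zero          _ = refl
  occ (suc zero)    _ = refl
  occ (suc (suc _)) (s≤s (s≤s ()))
  earlier : ∀ q → 1 ≤ q → q < 5 → ¬ OccursOnesAt 2 q
  earlier 1 _ _ occ′ = contradiction (occ′ 1 (s≤s (s≤s z≤n))) λ ()
  earlier 2 _ _ occ′ = contradiction (occ′ 0 (s≤s z≤n)) λ ()
  earlier 3 _ _ occ′ = contradiction (occ′ 1 (s≤s (s≤s z≤n))) λ ()
  earlier 4 _ _ occ′ = contradiction (occ′ 0 (s≤s z≤n)) λ ()
  earlier (suc (suc (suc (suc (suc _))))) _ (s≤s (s≤s (s≤s (s≤s (s≤s ()))))) _

r : ℕ → ℕ
r 0 = 0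
r 1 = 1
r 2 = 5
r (suc (suc (suc n))) = 2 ^ (r (suc (suc n)) ∸ 2) + r (suc (suc n))

2≤r : ∀ n → 2 ≤ r (2 + n)
2≤r zero    = s≤s (s≤s z≤n)
2≤r (suc n) = ≤-trans (2≤r n) (m≤n+m _ _)

r-firstOcc : ∀ n → IsFirstOcc (suc n) (r (suc n))
r-firstOcc zero          = firstOcc-1
r-firstOcc (suc zero)    = firstOcc-2
r-firstOcc (suc (suc n)) =
  subst (IsFirstOcc (3 + n)) ℓj≡r
    (firstOcc-step (subst (IsFirstOcc (2 + n)) (sym 2+j≡r) (r-firstOcc (suc n))))
  where
  j : ℕ
  j = r (2 + n) ∸ 2
  2+j≡r : 2 + j ≡ r (2 + n)
  2+j≡r = m+[n∸m]≡n (2≤r n)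
  ℓj≡r : ℓ j ≡ r (3 + n)
  ℓj≡r = trans (ℓ≡2^i+[2+i] j) (cong (2 ^ j +_) 2+j≡r)

theorem4 : Σ (ℕ → ℕ) (λ r → ((n : ℕ) → 1 ≤ n → IsFirstOcc n (r n))
               × (r 1 ≡ 1) × (r 2 ≡ 5)
               × ((n : ℕ) → 2 ≤ n → r (n + 1) ≡ 2 ^ (r n ∸ 2) + r n))
theorem4 = r , (λ { (suc n) _ → r-firstOcc n }) , refl , refl , recurrence
  where
  recurrence : (n : ℕ) → 2 ≤ n → r (n + 1) ≡ 2 ^ (r n ∸ 2) + r n
  recurrence 0             ()
  recurrence 1             (s≤s ())
  recurrence (suc (suc n)) _ = cong r (+-comm (2 + n) 1)
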